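{- Let $X$ be a finite set and $f\in\mathrm{Bool}(X)$. Assume there exists $x\in X$ such that for all $y\in X\setminus\{x\}$, $f(\{x,y\})\neq f(\{x\})+f(\{y\})$. Then $f$ is indecomposable.
   Context: A boolean function on a finite set $X$ is a map $f:\mathcal{P}(X)\to\mathbb{Z}$ with $f(\emptyset)=0$; $\mathrm{Bool}(X)$ is the set of them. For disjoint $X,Y$, $f\in\mathrm{Bool}(X)$, $g\in\mathrm{Bool}(Y)$, $f\star_1g\in\mathrm{Bool}(X\sqcup Y)$ is $f\star_1 g(A)=f(A\cap X)+g(A\cap Y)$. For nonempty $X$, $f\in\mathrm{Bool}(X)$ is indecomposable if for every $Y\subseteq X$, $f'\in\mathrm{Bool}(X\setminus Y)$, $f''\in\mathrm{Bool}(Y)$, the equality $f=f'\star_1 f''$ implies $Y=\emptyset$ or $Y=X$. -}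

module Defs where

open import Data.Nat using (ℕ; _<_)
open import Data.Integer using (ℤ; _+_; 0ℤ)
open import Data.Fin.Subset using (Subset; _∩_; ∁; ⊥; ⊤)
open import Data.Product using (_×_)
open import Data.Sum using (_⊎_)
open import Relation.Binary.PropositionalEquality using (_≡_)

-- The finite set X is modelled as Fin n; its subsets are  Subset n.
-- A set function on X:
SetFun : ℕ → Set
SetFun n = Subset n → ℤ

IsBool : {n : ℕ} → SetFun n → Set
IsBool f = f ⊥ ≡ 0ℤ

-- A boolean function on a subset Z ⊆ X is represented by a function on
-- Subset n of which only the values on subsets of Z are ever used
-- (it is evaluated only at A ∩ Z); f' ⋆₁ f'' (A) = f'(A ∖ Y) + f''(A ∩ Y).
_⋆₁[_]_ : {n : ℕ} → SetFun n → Subset n → SetFun n → SetFun n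
(f′ ⋆₁[ Y ] f″) A = f′ (A ∩ ∁ Y) + f″ (A ∩ Y)

Indecomposable : {n : ℕ} → SetFun n → Set
Indecomposable {n} f =
  (0 < n) ×
  ((Y : Subset n) (f′ f″ : SetFun n) →
     IsBool f′ → IsBool f″ →
     ((A : Subset n) → f A ≡ (f′ ⋆₁[ Y ] f″) A) →
     (Y ≡ ⊥) ⊎ (Y ≡ ⊤))

{-# OPTIONS --safe #-}
module Submission where

-- A decomposition f = f′ ⋆₁ f″ along Y makes f additive on every pair {x, y} with
-- x ∉ Y and y ∈ Y, since f′ only sees x and f″ only sees y. If x is non-additive
-- with every other point, then x and all of X must lie on the same side of Y.

open import Defs
open import Data.Nat using (ℕ; suc)
open import Data.Nat.Properties using (0<1+n)
open import Data.Fin using (Fin)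
open import Data.Fin.Subset using (Subset; ⁅_⁆; _∪_; _∩_; ∁; ⊥; ⊤; _∈_; _∉_; Empty)
open import Data.Fin.Subset.Properties
  using (_∈?_; Empty-unique; ⊆-antisym; ⊆⊤; p∩q⊆p; x∈p∩q⁺; x∈p∩q⁻; x∈⁅y⁆⇒x≡y;
         x∈p⇒x∉∁p; x∉p⇒x∈∁p; x∈∁p⇒x∉p; x∉∁p⇒x∈p;
         ∪-comm; ∪-identityˡ; ∪-identityʳ; ∩-distribʳ-∪)
open import Data.Integer using (_+_; 0ℤ)
open import Data.Integer.Properties using (+-comm; +-identityˡ; +-identityʳ)
open import Data.Product using (∃; _,_)
open import Data.Sum using (_⊎_; inj₁; inj₂)
open import Relation.Nullary using (¬_; yes; no)
open import Relation.Binary.PropositionalEquality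

private variable
  n : ℕ
  x y : Fin n
  p Y : Subset n
  f : SetFun n

AdditiveOn : SetFun n → Fin n → Fin n → Set
AdditiveOn f x y = f (⁅ x ⁆ ∪ ⁅ y ⁆) ≡ f ⁅ x ⁆ + f ⁅ y ⁆

AdditiveOn-sym : AdditiveOn f x y → AdditiveOn f y x
AdditiveOn-sym {f = f} {x} {y} additive = begin
  f (⁅ y ⁆ ∪ ⁅ x ⁆)  ≡⟨ cong f (∪-comm ⁅ y ⁆ ⁅ x ⁆) ⟩
  f (⁅ x ⁆ ∪ ⁅ y ⁆)  ≡⟨ additive ⟩
  f ⁅ x ⁆ + f ⁅ y ⁆  ≡⟨ +-comm (f ⁅ x ⁆) (f ⁅ y ⁆) ⟩
  f ⁅ y ⁆ + f ⁅ x ⁆  ∎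
  where open ≡-Reasoning

⁅x⁆∩p≡⁅x⁆ : x ∈ p → ⁅ x ⁆ ∩ p ≡ ⁅ x ⁆
⁅x⁆∩p≡⁅x⁆ {x = x} {p = p} x∈p = ⊆-antisym (p∩q⊆p ⁅ x ⁆ p) ⁅x⁆⊆⁅x⁆∩p
  where
  ⁅x⁆⊆⁅x⁆∩p : ∀ {z} → z ∈ ⁅ x ⁆ → z ∈ ⁅ x ⁆ ∩ p
  ⁅x⁆⊆⁅x⁆∩p z∈⁅x⁆ with refl ← x∈⁅y⁆⇒x≡y x z∈⁅x⁆ = x∈p∩q⁺ (z∈⁅x⁆ , x∈p)

⁅x⁆∩p≡⊥ : x ∉ p → ⁅ x ⁆ ∩ p ≡ ⊥
⁅x⁆∩p≡⊥ {x = x} {p = p} x∉p = Empty-unique ⁅x⁆∩p-empty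
  where
  ⁅x⁆∩p-empty : Empty (⁅ x ⁆ ∩ p)
  ⁅x⁆∩p-empty (z , z∈⁅x⁆∩p) with x∈p∩q⁻ ⁅ x ⁆ p z∈⁅x⁆∩p
  ... | z∈⁅x⁆ , z∈p with refl ← x∈⁅y⁆⇒x≡y x z∈⁅x⁆ = x∉p z∈p

⋆₁-⁅outside⁆ : (f′ f″ : SetFun n) → IsBool f″ → x ∉ Y → (f′ ⋆₁[ Y ] f″) ⁅ x ⁆ ≡ f′ ⁅ x ⁆
⋆₁-⁅outside⁆ {x = x} {Y = Y} f′ f″ f″-bool x∉Y = begin
  f′ (⁅ x ⁆ ∩ ∁ Y) + f″ (⁅ x ⁆ ∩ Y)  ≡⟨ cong₂ (λ A B → f′ A + f″ B)
                                          (⁅x⁆∩p≡⁅x⁆ (x∉p⇒x∈∁p x∉Y)) (⁅x⁆∩p≡⊥ x∉Y) ⟩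
  f′ ⁅ x ⁆ + f″ ⊥                    ≡⟨ cong (f′ ⁅ x ⁆ +_) f″-bool ⟩
  f′ ⁅ x ⁆ + 0ℤ                      ≡⟨ +-identityʳ (f′ ⁅ x ⁆) ⟩
  f′ ⁅ x ⁆                           ∎
  where open ≡-Reasoning

⋆₁-⁅inside⁆ : (f′ f″ : SetFun n) → IsBool f′ → y ∈ Y → (f′ ⋆₁[ Y ] f″) ⁅ y ⁆ ≡ f″ ⁅ y ⁆
⋆₁-⁅inside⁆ {y = y} {Y = Y} f′ f″ f′-bool y∈Y = begin
  f′ (⁅ y ⁆ ∩ ∁ Y) + f″ (⁅ y ⁆ ∩ Y)  ≡⟨ cong₂ (λ A B → f′ A + f″ B)
                                          (⁅x⁆∩p≡⊥ (x∈p⇒x∉∁p y∈Y)) (⁅x⁆∩p≡⁅x⁆ y∈Y) ⟩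
  f′ ⊥ + f″ ⁅ y ⁆                    ≡⟨ cong (_+ f″ ⁅ y ⁆) f′-bool ⟩
  0ℤ + f″ ⁅ y ⁆                      ≡⟨ +-identityˡ (f″ ⁅ y ⁆) ⟩
  f″ ⁅ y ⁆                           ∎
  where open ≡-Reasoning

⋆₁-⁅outside⁆∪⁅inside⁆ : (f′ f″ : SetFun n) → x ∉ Y → y ∈ Y →
  (f′ ⋆₁[ Y ] f″) (⁅ x ⁆ ∪ ⁅ y ⁆) ≡ f′ ⁅ x ⁆ + f″ ⁅ y ⁆
⋆₁-⁅outside⁆∪⁅inside⁆ {x = x} {Y = Y} {y = y} f′ f″ x∉Y y∈Y = begin
  f′ ((⁅ x ⁆ ∪ ⁅ y ⁆) ∩ ∁ Y) + f″ ((⁅ x ⁆ ∪ ⁅ y ⁆) ∩ Y)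
    ≡⟨ cong₂ (λ A B → f′ A + f″ B) (∩-distribʳ-∪ (∁ Y) ⁅ x ⁆ ⁅ y ⁆) (∩-distribʳ-∪ Y ⁅ x ⁆ ⁅ y ⁆) ⟩
  f′ ((⁅ x ⁆ ∩ ∁ Y) ∪ (⁅ y ⁆ ∩ ∁ Y)) + f″ ((⁅ x ⁆ ∩ Y) ∪ (⁅ y ⁆ ∩ Y))
    ≡⟨ cong₂ (λ A B → f′ A + f″ B)
         (cong₂ _∪_ (⁅x⁆∩p≡⁅x⁆ (x∉p⇒x∈∁p x∉Y)) (⁅x⁆∩p≡⊥ (x∈p⇒x∉∁p y∈Y)))
         (cong₂ _∪_ (⁅x⁆∩p≡⊥ x∉Y) (⁅x⁆∩p≡⁅x⁆ y∈Y)) ⟩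
  f′ (⁅ x ⁆ ∪ ⊥) + f″ (⊥ ∪ ⁅ y ⁆)
    ≡⟨ cong₂ (λ A B → f′ A + f″ B) (∪-identityʳ ⁅ x ⁆) (∪-identityˡ ⁅ y ⁆) ⟩
  f′ ⁅ x ⁆ + f″ ⁅ y ⁆
    ∎
  where open ≡-Reasoning

⋆₁-additiveOn-separated : (f′ f″ : SetFun n) → IsBool f′ → IsBool f″ → x ∉ Y → y ∈ Y →
  AdditiveOn (f′ ⋆₁[ Y ] f″) x y
⋆₁-additiveOn-separated f′ f″ f′-bool f″-bool x∉Y y∈Y =
  trans (⋆₁-⁅outside⁆∪⁅inside⁆ f′ f″ x∉Y y∈Y)
        (sym (cong₂ _+_ (⋆₁-⁅outside⁆ f′ f″ f″-bool x∉Y) (⋆₁-⁅inside⁆ f′ f″ f′-bool y∈Y)))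

module _ {f : SetFun n} {Y : Subset n} (f′ f″ : SetFun n)
         (f′-bool : IsBool f′) (f″-bool : IsBool f″) (f≗f′⋆₁f″ : f ≗ f′ ⋆₁[ Y ] f″) where

  additiveOn-separated : x ∉ Y → y ∈ Y → AdditiveOn f x y
  additiveOn-separated {x = x} {y = y} x∉Y y∈Y = begin
    f (⁅ x ⁆ ∪ ⁅ y ⁆)
      ≡⟨ f≗f′⋆₁f″ (⁅ x ⁆ ∪ ⁅ y ⁆) ⟩
    (f′ ⋆₁[ Y ] f″) (⁅ x ⁆ ∪ ⁅ y ⁆)
      ≡⟨ ⋆₁-additiveOn-separated f′ f″ f′-bool f″-bool x∉Y y∈Y ⟩
    (f′ ⋆₁[ Y ] f″) ⁅ x ⁆ + (f′ ⋆₁[ Y ] f″) ⁅ y ⁆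
      ≡⟨ sym (cong₂ _+_ (f≗f′⋆₁f″ ⁅ x ⁆) (f≗f′⋆₁f″ ⁅ y ⁆)) ⟩
    f ⁅ x ⁆ + f ⁅ y ⁆
      ∎
    where open ≡-Reasoning

  trivial-if-nonadditiveAt : (x : Fin n) → (∀ y → y ≢ x → ¬ AdditiveOn f x y) → Y ≡ ⊥ ⊎ Y ≡ ⊤
  trivial-if-nonadditiveAt x nonadditive with x ∈? Y
  ... | no x∉Y = inj₁ (Empty-unique λ (y , y∈Y) →
          nonadditive y (λ { refl → x∉Y y∈Y }) (additiveOn-separated x∉Y y∈Y))
  ... | yes x∈Y = inj₂ (⊆-antisym ⊆⊤ λ {y} _ → x∉∁p⇒x∈p λ y∈∁Y →
          nonadditive y (λ { refl → x∈∁p⇒x∉p y∈∁Y x∈Y })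
            (AdditiveOn-sym {f = f} (additiveOn-separated (x∈∁p⇒x∉p y∈∁Y) x∈Y)))

proposition2p17 : (n : ℕ) (f : SetFun n) → IsBool f →
    ∃ (λ (x : Fin n) → (y : Fin n) → y ≢ x →
        f (⁅ x ⁆ ∪ ⁅ y ⁆) ≢ f ⁅ x ⁆ + f ⁅ y ⁆) →
    Indecomposable f
proposition2p17 (suc n) f _ (x , nonadditive) =
  0<1+n , λ Y f′ f″ f′-bool f″-bool f≗f′⋆₁f″ →
    trivial-if-nonadditiveAt f′ f″ f′-bool f″-bool f≗f′⋆₁f″ x nonadditive
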